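{- Let $p$ be a prime and let $f:\mathbb{Z}_p\to\mathbb{Z}_p$ be Lipschitz and satisfy \[ \frac{f(s)-f(t)}{s-t}\equiv0\pmod{p\mathbb{Z}_p}\quad\text{for all } s\ne t,\ s,t\in\mathbb{Z}_p. \] Then: (1) $f$ has a fixed point $\tau\in\mathbb{Z}_p$; (2) if $\xi\in\mathbb{Z}_p$ satisfies $f(\xi)\in p^n\mathbb{Z}_p$ for some $n\ge1$, then there is a function $f_n$ of level $n$ of $f$ with $\xi_n\equiv\xi\pmod{p^n\mathbb{Z}_p}$ and $f_n(s)\equiv p^{ -n}f(\xi)\pmod{p\mathbb{Z}_p}$ for all $s\in\mathbb{Z}_p$.
   Context: For $f:\mathbb{Z}_p\to\mathbb{Z}_p$ continuous and $n\ge0$, a function of level $n$ of $f$ is a function $f_n(s)=p^{ -n}f(\xi_n+sp^n)$, $s\in\mathbb{Z}_p$, which takes values in $\mathbb{Z}_p$, where $\xi_0=0$ and, for $n\ge1$, $\xi_n=s_0+s_1p+\cdots+s_{n-1}p^{n-1}$ with digits $0\le s_i<p$ (i.e. $\xi_n$ is an integer with $0\le\xi_n<p^n$). -}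

module Defs where

open import Data.Nat using (ℕ; zero; suc; _+_; _∸_; _<_; _<?_)
open import Data.Fin using (Fin; toℕ; fromℕ<)
open import Relation.Nullary using (yes; no)
open import Relation.Binary.PropositionalEquality using (_≡_)

-- The p-adic integers ℤ_p, represented by their (unique) p-adic digit
-- expansions x = Σ_i x(i) p^i with digits 0 ≤ x(i) < p.
-- Equality of p-adic integers is pointwise equality of digits.
ℤₚ : ℕ → Set
ℤₚ p = ℕ → Fin p

_≡_[mod-p^_] : ∀ {p} → ℤₚ p → ℤₚ p → ℕ → Set
x ≡ y [mod-p^ k ] = ∀ i → i < k → x i ≡ y i

InPow : ∀ {p} → ℕ → ℤₚ p → Set
InPow k x = ∀ i → i < k → toℕ (x i) ≡ 0

_≈ₚ_ : ∀ {p} → ℤₚ p → ℤₚ p → Set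
x ≈ₚ y = ∀ i → x i ≡ y i

-- An integer ξₙ = s₀ + s₁ p + … + s_{n-1} p^{n-1} with digits 0 ≤ sᵢ < p
-- (ξ₀ = 0 is the empty digit list), viewed as an element of ℤ_p.
Digits : ℕ → ℕ → Set
Digits p n = Fin n → Fin p

-- ξₙ + s pⁿ  for ξₙ given by its n digits and s ∈ ℤ_p.
glue : ∀ {p n} → Digits p n → ℤₚ p → ℤₚ p
glue {p} {n} d s i with i <? n
... | yes i<n = d (fromℕ< i<n)
... | no  _   = s (i ∸ n)

-- p^{-n} y  for y ∈ p^n ℤ_p  (shift the digits down by n).
shiftDown : ∀ {p} → ℕ → ℤₚ p → ℤₚ p
shiftDown n y i = y (i + n)

-- Function of level n of f attached to the digits d of ξₙ:
--   fₙ(s) = p^{-n} f(ξₙ + s pⁿ).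
levelFun : ∀ {p} → (ℤₚ p → ℤₚ p) → (n : ℕ) → Digits p n → ℤₚ p → ℤₚ p
levelFun f n d s = shiftDown n (f (glue d s))

-- fₙ is a function of level n of f: f(ξₙ + s pⁿ) ∈ pⁿ ℤ_p for all s,
-- i.e. fₙ takes values in ℤ_p.
IsLevelFun : ∀ {p} → (ℤₚ p → ℤₚ p) → (n : ℕ) → Digits p n → Set
IsLevelFun f n d = ∀ s → InPow n (f (glue d s))

{-# OPTIONS --safe #-}
-- The hypothesis says that f sends points congruent mod pᵏ to points congruent
-- mod pᵏ⁺¹. Hence the iterates xₖ = fᵏ(x₀) satisfy xₖ₊₁ ≡ xₖ (mod pᵏ), so the
-- digit i of xₖ is constant for k > i; the digit-wise limit τ of the iterates
-- is a fixed point. For (2), take ξₙ to be the first n digits of ξ: then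
-- ξₙ + s pⁿ ≡ ξ (mod pⁿ), so f(ξₙ + s pⁿ) ≡ f(ξ) (mod pⁿ⁺¹), which gives both
-- f(ξₙ + s pⁿ) ∈ pⁿ ℤₚ and fₙ(s) ≡ p⁻ⁿ f(ξ) (mod p).
module Submission where

open import Defs
open import Data.Nat using (ℕ; zero; suc; _≤_; _<?_; _+_; NonZero; _≤′_; ≤′-refl; ≤′-step)
open import Data.Nat.Properties using (≤-refl; ≤-trans; n≤1+n; ≤⇒≤′; ≤′⇒≤; +-monoˡ-<)
open import Data.Nat.GeneralisedArithmetic using (fold)
open import Data.Nat.Primality using (Prime; prime⇒nonZero)
open import Data.Fin using (Fin; toℕ)
open import Data.Fin.Properties using (toℕ-fromℕ<)
open import Data.Product using (Σ; _×_; _,_)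
open import Relation.Nullary using (yes; no)
open import Relation.Nullary.Negation using (contradiction)
open import Relation.Binary.PropositionalEquality using (_≡_; refl; sym; trans; cong)

Contracting : ∀ {p} → (ℤₚ p → ℤₚ p) → Set
Contracting f = ∀ s t k → s ≡ t [mod-p^ k ] → f s ≡ f t [mod-p^ suc k ]

zeroₚ : ∀ {p} → NonZero p → ℤₚ p
zeroₚ {suc _} _ _ = Fin.zero

module _ {p : ℕ} where

  ≡-mod-weaken : ∀ {x y : ℤₚ p} {k m} → m ≤ k → x ≡ y [mod-p^ k ] → x ≡ y [mod-p^ m ]
  ≡-mod-weaken m≤k x≡y i i<m = x≡y i (≤-trans i<m m≤k)

  InPow-resp : ∀ {x y : ℤₚ p} {k} → x ≡ y [mod-p^ k ] → InPow k y → InPow k x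
  InPow-resp x≡y y∈pᵏ i i<k = trans (cong toℕ (x≡y i i<k)) (y∈pᵏ i i<k)

  shiftDown-resp : ∀ {x y : ℤₚ p} n {k} → x ≡ y [mod-p^ k + n ] →
                   shiftDown n x ≡ shiftDown n y [mod-p^ k ]
  shiftDown-resp n x≡y i i<k = x≡y (i + n) (+-monoˡ-< n i<k)

  digitsOf : (n : ℕ) → ℤₚ p → Digits p n
  digitsOf n ξ i = ξ (toℕ i)

  glue-digitsOf : ∀ n (ξ s : ℤₚ p) → glue (digitsOf n ξ) s ≡ ξ [mod-p^ n ]
  glue-digitsOf n ξ s i i<n with i <? n
  ... | yes i<n′ = cong ξ (toℕ-fromℕ< i<n′)
  ... | no  i≮n  = contradiction i<n i≮n

module Iteration {p : ℕ} {f : ℤₚ p → ℤₚ p} (contracting : Contracting f) (x₀ : ℤₚ p) where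

  x : ℕ → ℤₚ p
  x = fold x₀ f

  x-step : ∀ k → x (suc k) ≡ x k [mod-p^ k ]
  x-step zero    i ()
  x-step (suc k) = contracting (x (suc k)) (x k) k (x-step k)

  x-cauchy : ∀ {k m} → k ≤′ m → x m ≡ x k [mod-p^ k ]
  x-cauchy ≤′-refl           i i<k = refl
  x-cauchy (≤′-step {m} k≤m) i i<k =
    trans (x-step m i (≤-trans i<k (≤′⇒≤ k≤m))) (x-cauchy k≤m i i<k)

  limit : ℤₚ p
  limit i = x (suc i) i

  limit-approx : ∀ k → limit ≡ x k [mod-p^ k ]
  limit-approx k i i<k = sym (x-cauchy (≤⇒≤′ i<k) i ≤-refl)

  limit-fixed : f limit ≈ₚ limit
  limit-fixed i = contracting limit (x i) i (limit-approx i) i ≤-refl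

contracting⇒fixedPoint : ∀ {p} → NonZero p → {f : ℤₚ p → ℤₚ p} → Contracting f →
                         Σ (ℤₚ p) λ τ → f τ ≈ₚ τ
contracting⇒fixedPoint nz contracting =
  limit , limit-fixed
  where open Iteration contracting (zeroₚ nz)

module LevelFunction {p : ℕ} {f : ℤₚ p → ℤₚ p} (contracting : Contracting f)
                     (ξ : ℤₚ p) (n : ℕ) where

  f-glue-digitsOf : ∀ s → f (glue (digitsOf n ξ) s) ≡ f ξ [mod-p^ suc n ]
  f-glue-digitsOf s = contracting _ ξ n (glue-digitsOf n ξ s)

  isLevelFun : InPow n (f ξ) → IsLevelFun f n (digitsOf n ξ)
  isLevelFun fξ∈pⁿ s = InPow-resp (≡-mod-weaken (n≤1+n n) (f-glue-digitsOf s)) fξ∈pⁿ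

  levelFun-≡ : ∀ s → levelFun f n (digitsOf n ξ) s ≡ shiftDown n (f ξ) [mod-p^ 1 ]
  levelFun-≡ s = shiftDown-resp n (f-glue-digitsOf s)

proposition4p3 : (p : ℕ) → Prime p → (f : ℤₚ p → ℤₚ p) →
    (∀ s t k → s ≡ t [mod-p^ k ] → f s ≡ f t [mod-p^ suc k ]) →
    (Σ (ℤₚ p) λ τ → f τ ≈ₚ τ)
    × (∀ (ξ : ℤₚ p) (n : ℕ) → 1 ≤ n → InPow n (f ξ) →
        Σ (Digits p n) λ d →
          (∀ (i : Fin n) → d i ≡ ξ (toℕ i))
          × IsLevelFun f n d
          × (∀ s → levelFun f n d s ≡ shiftDown n (f ξ) [mod-p^ 1 ]))
proposition4p3 p p-prime f contracting =
  contracting⇒fixedPoint (prime⇒nonZero p-prime) contracting ,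
  λ ξ n _ fξ∈pⁿ →
    let open LevelFunction contracting ξ n
    in digitsOf n ξ , (λ _ → refl) , isLevelFun fξ∈pⁿ , levelFun-≡
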